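{- Let $\langle\mathbf{A}_{\mathrm d},\mathbf{A},\iota\rangle$ be a distributively generated (generalized) additive quantale with multiplication, let $\mathbf{Q}$ be an $\mathbf{A}$-module, and let $\vdash$ be an additive consequence relation on $\mathbf{Q}$ which is structural with respect to each $a\in\iota[\mathbf{A}_{\mathrm d}]$. Then $\vdash$ is structural (with respect to every $a\in\mathbf{A}$).
   Context: Fix one of two parallel settings: plain ("joins" = joins of arbitrary families) or generalized ("joins" = joins of non-empty families). A (generalized) quantale is $\langle Q,\bigvee,+,\mathsf{0}\rangle$ with $Q$ a poset having all such joins, $\langle Q,+,\mathsf{0}\rangle$ a monoid with $+$ order-preserving and distributing over such joins on both sides. A (generalized) additive quantale with multiplication is a triple $\langle\mathbf{A}_{\mathrm d},\mathbf{A},\iota\rangle$: $\mathbf{A}_{\mathrm d}$ a monoid, $\mathbf{A}$ a (generalized) quantale with an additional monoid structure $\langle A,\cdot,\mathsf 1\rangle$, $\iota\colon\mathbf{A}_{\mathrm d}\to\mathbf{A}$ a monoid homomorphism, such that $(\bigvee_i a_i)\cdot b=\bigvee_i(a_i\cdot b)$, $(a+b)\cdot c=a\cdot c+b\cdot c$, $\mathsf0\cdot a=\mathsf0$, and for $d\in\mathbf{A}_{\mathrm d}$ left multiplication by $\iota(d)$ preserves joins, $+$ and $\mathsf0$. It is distributively generated if $\mathbf{A}$ is generated as a (generalized) quantale by $\iota[\mathbf{A}_{\mathrm d}]$. An $\mathbf{A}$-module is a (generalized) quantale $\mathbf{Q}$ with a map $\ast\colon A\times Q\to Q$, order-preserving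 in both coordinates, with $(a\cdot b)\ast x=a\ast(b\ast x)$, $\mathsf1\ast x=x$, $(a+b)\ast x=a\ast x+b\ast x$, $\mathsf0\ast x=\mathsf0$, $(\bigvee_i a_i)\ast x=\bigvee_i(a_i\ast x)$, and for $d\in\mathbf{A}_{\mathrm d}$ the map $x\mapsto\iota(d)\ast x$ preserves $+$, $\mathsf0$ and joins. An additive consequence relation on $\mathbf{Q}$ is a relation $\vdash$ such that: $x\geq y$ implies $x\vdash y$; $\vdash$ is transitive; $x\vdash\bigvee\{y:x\vdash y\}$; and $x\vdash y$ implies $x+z\vdash y+z$ and $z+x\vdash z+y$. It is structural with respect to $a\in A$ if $x\vdash y$ implies $a\ast x\vdash a\ast y$. -}

module Defs where

open import Level using (Level; Lift; suc)
open import Data.Unit using (⊤)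
open import Data.Product using (Σ; proj₁)
open import Relation.Binary.Core using (Rel)
open import Relation.Binary.Structures using (IsPartialOrder)
open import Relation.Binary.PropositionalEquality using (_≡_)
open import Algebra.Core using (Op₂)
open import Algebra.Structures using (IsMonoid)

-- The two parallel settings: plain (joins of arbitrary families) and
-- generalized (joins of non-empty families).
data Setting : Set where
  plain generalized : Setting

Adm : Setting → ∀ {ℓ} → Set ℓ → Set ℓ
Adm plain       I = Lift _ ⊤
Adm generalized I = I

record IsQuantale (s : Setting) {ℓ : Level} {Q : Set ℓ}
                  (_≤_ : Rel Q ℓ)
                  (⋁ : {I : Set ℓ} → Adm s I → (I → Q) → Q)
                  (_+_ : Op₂ Q) (0# : Q) : Set (suc ℓ) where
  field
    isPartialOrder : IsPartialOrder _≡_ _≤_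
    ⋁-upper  : ∀ {I} (p : Adm s I) (f : I → Q) (i : I) → f i ≤ ⋁ p f
    ⋁-least  : ∀ {I} (p : Adm s I) (f : I → Q) (u : Q) →
               (∀ i → f i ≤ u) → ⋁ p f ≤ u
    +-isMonoid : IsMonoid _≡_ _+_ 0#
    +-mono   : ∀ {x x′ y y′} → x ≤ x′ → y ≤ y′ → (x + y) ≤ (x′ + y′)
    +-distribˡ-⋁ : ∀ (a : Q) {I} (p : Adm s I) (f : I → Q) →
                   (a + ⋁ p f) ≡ ⋁ p (λ i → a + f i)
    +-distribʳ-⋁ : ∀ (a : Q) {I} (p : Adm s I) (f : I → Q) →
                   (⋁ p f + a) ≡ ⋁ p (λ i → f i + a)

record Quantale (s : Setting) (ℓ : Level) : Set (suc ℓ) where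
  infix  4 _≤_
  infixl 6 _+_
  field
    Carrier    : Set ℓ
    _≤_        : Rel Carrier ℓ
    ⋁          : {I : Set ℓ} → Adm s I → (I → Carrier) → Carrier
    _+_        : Op₂ Carrier
    0#         : Carrier
    isQuantale : IsQuantale s _≤_ ⋁ _+_ 0#
  open IsQuantale isQuantale public

record AddQuantaleMult (s : Setting) (ℓ : Level) : Set (suc ℓ) where
  infixl 7 _·_
  field
    D          : Set ℓ
    _⊛_        : Op₂ D
    1d         : D
    D-isMonoid : IsMonoid _≡_ _⊛_ 1d
    A          : Quantale s ℓ
  open Quantale A
  field
    _·_        : Op₂ Carrier
    1#         : Carrier
    ·-isMonoid : IsMonoid _≡_ _·_ 1#
    ι          : D → Carrier
    ι-⊛        : ∀ d e → ι (d ⊛ e) ≡ ι d · ι e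
    ι-1        : ι 1d ≡ 1#
    ⋁-distribʳ-· : ∀ {I} (p : Adm s I) (f : I → Carrier) (b : Carrier) →
                   ⋁ p f · b ≡ ⋁ p (λ i → f i · b)
    +-distribʳ-· : ∀ a b c → (a + b) · c ≡ a · c + b · c
    zeroˡ-·      : ∀ a → 0# · a ≡ 0#
    ι-distribˡ-⋁ : ∀ d {I} (p : Adm s I) (f : I → Carrier) →
                   ι d · ⋁ p f ≡ ⋁ p (λ i → ι d · f i)
    ι-distribˡ-+ : ∀ d a b → ι d · (a + b) ≡ ι d · a + ι d · b
    ι-zeroʳ      : ∀ d → ι d · 0# ≡ 0#

module _ {s : Setting} {ℓ : Level} (𝔸 : AddQuantaleMult s ℓ) where
  open AddQuantaleMult 𝔸
  open Quantale A

  data Generated : Carrier → Set (suc ℓ) where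
    gen-ι : ∀ d → Generated (ι d)
    gen-0 : Generated 0#
    gen-+ : ∀ {a b} → Generated a → Generated b → Generated (a + b)
    gen-⋁ : ∀ {I : Set ℓ} (p : Adm s I) (f : I → Carrier) →
            (∀ i → Generated (f i)) → Generated (⋁ p f)

  DistributivelyGenerated : Set (suc ℓ)
  DistributivelyGenerated = ∀ a → Generated a

record Module {s : Setting} {ℓ : Level} (𝔸 : AddQuantaleMult s ℓ) : Set (suc ℓ) where
  open AddQuantaleMult 𝔸
  module 𝔸Q = Quantale A
  field
    Q   : Quantale s ℓ
  open Quantale Q
  infixr 7 _*_
  field
    _*_       : 𝔸Q.Carrier → Carrier → Carrier
    *-mono    : ∀ {a a′ x x′} → a 𝔸Q.≤ a′ → x ≤ x′ → a * x ≤ a′ * x′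
    *-assoc   : ∀ a b x → (a · b) * x ≡ a * (b * x)
    *-identity : ∀ x → 1# * x ≡ x
    *-distrib-+ : ∀ a b x → (a 𝔸Q.+ b) * x ≡ a * x + b * x
    *-zero    : ∀ x → 𝔸Q.0# * x ≡ 0#
    *-distrib-⋁ : ∀ {I} (p : Adm s I) (f : I → 𝔸Q.Carrier) (x : Carrier) →
                  𝔸Q.⋁ p f * x ≡ ⋁ p (λ i → f i * x)
    ι*-+ : ∀ d x y → ι d * (x + y) ≡ ι d * x + ι d * y
    ι*-0 : ∀ d → ι d * 0# ≡ 0#
    ι*-⋁ : ∀ d {I} (p : Adm s I) (f : I → Carrier) →
           ι d * ⋁ p f ≡ ⋁ p (λ i → ι d * f i)

record IsAdditiveConsequence {s : Setting} {ℓ : Level} (Q : Quantale s ℓ)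
       (_⊢_ : Rel (Quantale.Carrier Q) ℓ) : Set (suc ℓ) where
  open Quantale Q
  field
    ≥⇒⊢    : ∀ {x y} → y ≤ x → x ⊢ y
    ⊢-trans : ∀ {x y z} → x ⊢ y → y ⊢ z → x ⊢ z
    ⊢-⋁    : ∀ x (p : Adm s (Σ Carrier (x ⊢_))) → x ⊢ ⋁ p proj₁
    ⊢-+ʳ   : ∀ {x y} z → x ⊢ y → (x + z) ⊢ (y + z)
    ⊢-+ˡ   : ∀ {x y} z → x ⊢ y → (z + x) ⊢ (z + y)

StructuralWrt : ∀ {s ℓ} {𝔸 : AddQuantaleMult s ℓ} (M : Module 𝔸) →
                Rel (Quantale.Carrier (Module.Q M)) ℓ →
                Quantale.Carrier (AddQuantaleMult.A 𝔸) → Set ℓ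
StructuralWrt M _⊢_ a = ∀ {x y} → x ⊢ y → (a * x) ⊢ (a * y)
  where open Module M

-- The elements of A that ⊢ is structural for contain 0 and are closed under
-- + and admissible joins, because (a + b) * x = a * x + b * x,
-- (⋁ f) * x = ⋁ (f i * x), and an additive consequence relation is
-- compatible with + and with joins of pointwise related families.  Since
-- A is generated from ι[A_d] by these operations, structurality for ι[A_d]
-- propagates to all of A.
module Submission where

open import Defs
open import Level using (Level; lift)
open import Data.Unit using (tt)
open import Data.Product using (Σ; proj₁; _,_)
open import Relation.Binary.Core using (Rel)
open import Relation.Binary.Structures using (IsPartialOrder)
open import Relation.Binary.PropositionalEquality using (_≡_; refl; sym; trans; subst₂)

Adm-map : ∀ {s a b} {I : Set a} {J : Set b} → (I → J) → Adm s I → Adm s J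
Adm-map {plain}       _ _ = lift tt
Adm-map {generalized} f i = f i

module AdditiveConsequenceProperties
  {s : Setting} {ℓ : Level} {Q : Quantale s ℓ} {_⊢_ : Rel (Quantale.Carrier Q) ℓ}
  (isAdditiveConsequence : IsAdditiveConsequence Q _⊢_) where

  open Quantale Q
  open IsAdditiveConsequence isAdditiveConsequence

  ⊢-refl : ∀ {x} → x ⊢ x
  ⊢-refl = ≥⇒⊢ (IsPartialOrder.refl isPartialOrder)

  ⊢-reflexive : ∀ {x y} → x ≡ y → x ⊢ y
  ⊢-reflexive refl = ⊢-refl

  ⊢-+ : ∀ {x x′ y y′} → x ⊢ x′ → y ⊢ y′ → (x + y) ⊢ (x′ + y′)
  ⊢-+ {x′ = x′} {y = y} x⊢x′ y⊢y′ = ⊢-trans (⊢-+ʳ y x⊢x′) (⊢-+ˡ x′ y⊢y′)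

  -- ⋁ g proves every h i, hence proves the join of all its consequences,
  -- which lies above ⋁ h.
  ⊢-⋁-mono : ∀ {I : Set ℓ} (p : Adm s I) (g h : I → Carrier) →
              (∀ i → g i ⊢ h i) → ⋁ p g ⊢ ⋁ p h
  ⊢-⋁-mono p g h g⊢h = ⊢-trans (⊢-⋁ (⋁ p g) consequences) (≥⇒⊢ ⋁h≤⋁consequences)
    where
      ⋁g⊢h : ∀ i → ⋁ p g ⊢ h i
      ⋁g⊢h i = ⊢-trans (≥⇒⊢ (⋁-upper p g i)) (g⊢h i)

      consequences : Adm s (Σ Carrier (⋁ p g ⊢_))
      consequences = Adm-map (λ i → h i , ⋁g⊢h i) p

      ⋁h≤⋁consequences : ⋁ p h ≤ ⋁ consequences proj₁
      ⋁h≤⋁consequences =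
        ⋁-least p h _ (λ i → ⋁-upper consequences proj₁ (h i , ⋁g⊢h i))

module Structurality
  {s : Setting} {ℓ : Level} {𝔸 : AddQuantaleMult s ℓ} (M : Module 𝔸)
  {_⊢_ : Rel (Quantale.Carrier (Module.Q M)) ℓ}
  (isAdditiveConsequence : IsAdditiveConsequence (Module.Q M) _⊢_) where

  open Module M
  open AdditiveConsequenceProperties isAdditiveConsequence

  structural-0 : StructuralWrt M _⊢_ 𝔸Q.0#
  structural-0 {x} {y} _ = ⊢-reflexive (trans (*-zero x) (sym (*-zero y)))

  structural-+ : ∀ {a b} → StructuralWrt M _⊢_ a → StructuralWrt M _⊢_ b →
                 StructuralWrt M _⊢_ (a 𝔸Q.+ b)
  structural-+ {a} {b} a-str b-str {x} {y} x⊢y =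
    subst₂ _⊢_ (sym (*-distrib-+ a b x)) (sym (*-distrib-+ a b y))
      (⊢-+ (a-str x⊢y) (b-str x⊢y))

  structural-⋁ : ∀ {I : Set ℓ} (p : Adm s I) (f : I → 𝔸Q.Carrier) →
                 (∀ i → StructuralWrt M _⊢_ (f i)) → StructuralWrt M _⊢_ (𝔸Q.⋁ p f)
  structural-⋁ p f f-str {x} {y} x⊢y =
    subst₂ _⊢_ (sym (*-distrib-⋁ p f x)) (sym (*-distrib-⋁ p f y))
      (⊢-⋁-mono p (λ i → f i * x) (λ i → f i * y) (λ i → f-str i x⊢y))

  generated⇒structural : (∀ d → StructuralWrt M _⊢_ (AddQuantaleMult.ι 𝔸 d)) →
                         ∀ {a} → Generated 𝔸 a → StructuralWrt M _⊢_ a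
  generated⇒structural ι-str (gen-ι d)     = ι-str d
  generated⇒structural ι-str gen-0         = structural-0
  generated⇒structural ι-str (gen-+ ga gb) =
    structural-+ (generated⇒structural ι-str ga) (generated⇒structural ι-str gb)
  generated⇒structural ι-str (gen-⋁ p f gf) =
    structural-⋁ p f (λ i → generated⇒structural ι-str (gf i))

lemma5p7 : ∀ {s : Setting} {ℓ} (𝔸 : AddQuantaleMult s ℓ) →
           DistributivelyGenerated 𝔸 →
           (M : Module 𝔸) →
           (_⊢_ : Rel (Quantale.Carrier (Module.Q M)) ℓ) →
           IsAdditiveConsequence (Module.Q M) _⊢_ →
           (∀ d → StructuralWrt M _⊢_ (AddQuantaleMult.ι 𝔸 d)) →
           ∀ a → StructuralWrt M _⊢_ a
lemma5p7 𝔸 generated M _⊢_ isAdditiveConsequence ι-structural a =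
  generated⇒structural ι-structural (generated a)
  where open Structurality M isAdditiveConsequence
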